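{- For any nonnegative integers $a,b,c$, the coefficient of $q^n$ in the formal power series $$\frac{q^a}{1+q^c}+\frac{q^b}{(1-q^3)(1-q^4)}$$ is nonnegative for every integer $n\geq b+6$. -}

module Defs where

open import Data.Nat using (ℕ; zero; suc; _∸_; _≟_)
open import Data.Rational using (ℚ; 0ℚ; 1ℚ; _+_; _-_; _*_)
open import Data.Bool using (if_then_else_)
open import Relation.Nullary.Decidable using (⌊_⌋)

-- Formal power series in q with rational coefficients: n ↦ coefficient of q^n.
FPS : Set
FPS = ℕ → ℚ

sumBelow : (ℕ → ℚ) → ℕ → ℚ
sumBelow h zero    = 0ℚ
sumBelow h (suc m) = sumBelow h m + h m

q^ : ℕ → FPS
q^ k n = if ⌊ n ≟ k ⌋ then 1ℚ else 0ℚ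

infixl 6 _⊕_ _⊖_
infixl 7 _⊛_

_⊕_ : FPS → FPS → FPS
(f ⊕ g) n = f n + g n

_⊖_ : FPS → FPS → FPS
(f ⊖ g) n = f n - g n

_⊛_ : FPS → FPS → FPS
(f ⊛ g) n = sumBelow (λ i → f i * g (n ∸ i)) (suc n)

-- For c > 0 the recurrence f n = [n = a] - f (n - c) shows that the coefficients of q^a/(1+q^c)
-- vanish below a and otherwise lie in {-1, 0, 1}; for c = 0 the series is q^a/2.
-- For g = q^b/((1-q^3)(1-q^4)), let G be g delayed by 7, so that its recurrence needs no boundary
-- cases. The differences Δ m = G (m+4) - G m satisfy Δ (m+3) = Δ m + [m = b], hence Δ ≥ 0 and
-- Δ ≥ 1 at b + 3 + 3k, so G ≥ 1 at b + 7 + 3k + 4l; and every integer ≥ 6 is of the form 3k + 4l.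
module Submission where

open import Data.Nat using (ℕ; zero; suc; _+_; _*_; _≤_; _<_; _∸_; _≟_)
import Data.Nat.Properties as ℕ
open import Data.Nat.Induction using (<-rec)
open import Data.Nat.Tactic.RingSolver using (solve-∀)
open import Data.Rational using (ℚ; 0ℚ; 1ℚ; -_) renaming (_+_ to _+ℚ_; _-_ to _-ℚ_; _*_ to _*ℚ_; _≤_ to _≤ℚ_)
import Data.Rational.Properties as ℚ
open import Data.Rational.Solver using (module +-*-Solver)
open import Data.Product using (∃₂; _,_)
open import Function using (_∘_; case_of_)
open import Relation.Binary.PropositionalEquality
open import Relation.Nullary using (yes; no)
open import Relation.Nullary.Decidable using (from-yes)
open import Relation.Nullary.Negation using (contradiction)
import Algebra.Properties.CommutativeSemigroup as CommSemigroupProperties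
open import Algebra.Bundles using (CommutativeMonoid)

open import Defs

open +-*-Solver
open ≡-Reasoning

sumBelow-cong : ∀ {h k} → h ≗ k → ∀ m → sumBelow h m ≡ sumBelow k m
sumBelow-cong h≗k zero    = refl
sumBelow-cong h≗k (suc m) = cong₂ _+ℚ_ (sumBelow-cong h≗k m) (h≗k m)

sumBelow-zero : ∀ {h} → (∀ i → h i ≡ 0ℚ) → ∀ m → sumBelow h m ≡ 0ℚ
sumBelow-zero h≗0 zero    = refl
sumBelow-zero h≗0 (suc m) = cong₂ _+ℚ_ (sumBelow-zero h≗0 m) (h≗0 m)

sumBelow-+ : ∀ h k m → sumBelow (λ i → h i +ℚ k i) m ≡ sumBelow h m +ℚ sumBelow k m
sumBelow-+ h k zero    = refl
sumBelow-+ h k (suc m) = trans (cong (_+ℚ (h m +ℚ k m)) (sumBelow-+ h k m))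
                               (interchange (sumBelow h m) (sumBelow k m) (h m) (k m))
  where
  open CommSemigroupProperties (CommutativeMonoid.commutativeSemigroup ℚ.+-0-commutativeMonoid)
    using (interchange)

sumBelow-neg : ∀ h m → sumBelow (λ i → - h i) m ≡ - sumBelow h m
sumBelow-neg h zero    = refl
sumBelow-neg h (suc m) = trans (cong (_+ℚ - h m) (sumBelow-neg h m))
                               (sym (ℚ.neg-distrib-+ (sumBelow h m) (h m)))

sumBelow-- : ∀ h k m → sumBelow (λ i → h i -ℚ k i) m ≡ sumBelow h m -ℚ sumBelow k m
sumBelow-- h k m = trans (sumBelow-+ h (-_ ∘ k) m) (cong (sumBelow h m +ℚ_) (sumBelow-neg k m))

sumBelow-suc : ∀ h m → sumBelow h (suc m) ≡ h 0 +ℚ sumBelow (h ∘ suc) m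
sumBelow-suc h zero    = ℚ.+-comm 0ℚ (h 0)
sumBelow-suc h (suc m) = trans (cong (_+ℚ h (suc m)) (sumBelow-suc h m))
                               (ℚ.+-assoc (h 0) (sumBelow (h ∘ suc) m) (h (suc m)))

⊛-congˡ : ∀ {f f′} → f ≗ f′ → ∀ h → f ⊛ h ≗ f′ ⊛ h
⊛-congˡ f≗f′ h n = sumBelow-cong (λ i → cong (_*ℚ h (n ∸ i)) (f≗f′ i)) (suc n)

⊛-distribʳ-⊕ : ∀ f g h → (f ⊕ g) ⊛ h ≗ f ⊛ h ⊕ g ⊛ h
⊛-distribʳ-⊕ f g h n = begin
  sumBelow (λ i → (f i +ℚ g i) *ℚ h (n ∸ i)) (suc n)
    ≡⟨ sumBelow-cong (λ i → ℚ.*-distribʳ-+ (h (n ∸ i)) (f i) (g i)) (suc n) ⟩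
  sumBelow (λ i → f i *ℚ h (n ∸ i) +ℚ g i *ℚ h (n ∸ i)) (suc n)
    ≡⟨ sumBelow-+ _ _ (suc n) ⟩
  (f ⊛ h) n +ℚ (g ⊛ h) n ∎

⊛-distribʳ-⊖ : ∀ f g h → (f ⊖ g) ⊛ h ≗ f ⊛ h ⊖ g ⊛ h
⊛-distribʳ-⊖ f g h n = begin
  sumBelow (λ i → (f i -ℚ g i) *ℚ h (n ∸ i)) (suc n)
    ≡⟨ sumBelow-cong (λ i → distrib (f i) (g i) (h (n ∸ i))) (suc n) ⟩
  sumBelow (λ i → f i *ℚ h (n ∸ i) -ℚ g i *ℚ h (n ∸ i)) (suc n)
    ≡⟨ sumBelow-- _ _ (suc n) ⟩
  (f ⊛ h) n -ℚ (g ⊛ h) n ∎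
  where
  distrib : ∀ x y z → (x -ℚ y) *ℚ z ≡ x *ℚ z -ℚ y *ℚ z
  distrib = solve 3 (λ x y z → (x :- y) :* z := x :* z :- y :* z) refl

q^-diag : ∀ k → q^ k k ≡ 1ℚ
q^-diag k with k ≟ k
... | yes _   = refl
... | no k≢k = contradiction refl k≢k

q^-off : ∀ {k n} → n ≢ k → q^ k n ≡ 0ℚ
q^-off {k} {n} n≢k with n ≟ k
... | yes n≡k = contradiction n≡k n≢k
... | no _    = refl

q^-suc : ∀ k n → q^ (suc k) (suc n) ≡ q^ k n
q^-suc k n = case n ≟ k of λ where
  (yes refl) → trans (q^-diag (suc n)) (sym (q^-diag n))
  (no n≢k)   → trans (q^-off (n≢k ∘ ℕ.suc-injective)) (sym (q^-off n≢k))

q^-nonneg : ∀ k n → 0ℚ ≤ℚ q^ k n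
q^-nonneg k n with n ≟ k
... | yes _ = from-yes (0ℚ ℚ.≤? 1ℚ)
... | no _  = ℚ.≤-refl

shift : ℕ → FPS → FPS
shift zero    h n       = h n
shift (suc k) h zero    = 0ℚ
shift (suc k) h (suc n) = shift k h n

shift-⊖ : ∀ k f g → shift k (f ⊖ g) ≗ shift k f ⊖ shift k g
shift-⊖ zero    f g n       = refl
shift-⊖ (suc k) f g zero    = refl
shift-⊖ (suc k) f g (suc n) = shift-⊖ k f g n

shift-q^ : ∀ k j → shift k (q^ j) ≗ q^ (k + j)
shift-q^ zero    j n       = refl
shift-q^ (suc k) j zero    = refl
shift-q^ (suc k) j (suc n) = trans (shift-q^ k j n) (sym (q^-suc (k + j) n))

q^-⊛ : ∀ k h → q^ k ⊛ h ≗ shift k h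
q^-⊛ zero h n = begin
  sumBelow (λ i → q^ 0 i *ℚ h (n ∸ i)) (suc n)
    ≡⟨ sumBelow-suc _ n ⟩
  1ℚ *ℚ h n +ℚ sumBelow (λ i → 0ℚ *ℚ h (n ∸ suc i)) n
    ≡⟨ cong₂ _+ℚ_ (ℚ.*-identityˡ (h n)) (sumBelow-zero (λ i → ℚ.*-zeroˡ (h (n ∸ suc i))) n) ⟩
  h n +ℚ 0ℚ
    ≡⟨ ℚ.+-identityʳ (h n) ⟩
  h n ∎
q^-⊛ (suc k) h zero = trans (ℚ.+-identityˡ (0ℚ *ℚ h 0)) (ℚ.*-zeroˡ (h 0))
q^-⊛ (suc k) h (suc n) = begin
  sumBelow (λ i → q^ (suc k) i *ℚ h (suc n ∸ i)) (suc (suc n))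
    ≡⟨ sumBelow-suc _ (suc n) ⟩
  0ℚ *ℚ h (suc n) +ℚ sumBelow (λ i → q^ (suc k) (suc i) *ℚ h (n ∸ i)) (suc n)
    ≡⟨ cong₂ _+ℚ_ (ℚ.*-zeroˡ (h (suc n)))
             (sumBelow-cong (λ i → cong (_*ℚ h (n ∸ i)) (q^-suc k i)) (suc n)) ⟩
  0ℚ +ℚ (q^ k ⊛ h) n
    ≡⟨ ℚ.+-identityˡ _ ⟩
  (q^ k ⊛ h) n
    ≡⟨ q^-⊛ k h n ⟩
  shift k h n ∎

⊛-1+q^ : ∀ c f → (q^ 0 ⊕ q^ c) ⊛ f ≗ f ⊕ shift c f
⊛-1+q^ c f n =
  trans (⊛-distribʳ-⊕ (q^ 0) (q^ c) f n) (cong₂ _+ℚ_ (q^-⊛ 0 f n) (q^-⊛ c f n))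

[1-q³][1-q⁴]≗1-q³-q⁴+q⁷ : (q^ 0 ⊖ q^ 3) ⊛ (q^ 0 ⊖ q^ 4) ≗ q^ 0 ⊖ q^ 3 ⊖ q^ 4 ⊕ q^ 7
[1-q³][1-q⁴]≗1-q³-q⁴+q⁷ i = begin
  ((q^ 0 ⊖ q^ 3) ⊛ (q^ 0 ⊖ q^ 4)) i
    ≡⟨ ⊛-distribʳ-⊖ (q^ 0) (q^ 3) (q^ 0 ⊖ q^ 4) i ⟩
  ((q^ 0 ⊛ (q^ 0 ⊖ q^ 4)) ⊖ (q^ 3 ⊛ (q^ 0 ⊖ q^ 4))) i
    ≡⟨ cong₂ _-ℚ_ (q^-⊛ 0 (q^ 0 ⊖ q^ 4) i)
                  (trans (q^-⊛ 3 (q^ 0 ⊖ q^ 4) i) (shift-⊖ 3 (q^ 0) (q^ 4) i)) ⟩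
  (q^ 0 i -ℚ q^ 4 i) -ℚ (shift 3 (q^ 0) i -ℚ shift 3 (q^ 4) i)
    ≡⟨ cong (λ x → (q^ 0 i -ℚ q^ 4 i) -ℚ x) (cong₂ _-ℚ_ (shift-q^ 3 0 i) (shift-q^ 3 4 i)) ⟩
  (q^ 0 i -ℚ q^ 4 i) -ℚ (q^ 3 i -ℚ q^ 7 i)
    ≡⟨ solve 4 (λ x y z w → (x :- z) :- (y :- w) := x :- y :- z :+ w) refl
             (q^ 0 i) (q^ 3 i) (q^ 4 i) (q^ 7 i) ⟩
  (q^ 0 ⊖ q^ 3 ⊖ q^ 4 ⊕ q^ 7) i ∎

⊛-[1-q³][1-q⁴] : ∀ g → (q^ 0 ⊖ q^ 3) ⊛ (q^ 0 ⊖ q^ 4) ⊛ g ≗ g ⊖ shift 3 g ⊖ shift 4 g ⊕ shift 7 g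
⊛-[1-q³][1-q⁴] g n = begin
  ((q^ 0 ⊖ q^ 3) ⊛ (q^ 0 ⊖ q^ 4) ⊛ g) n
    ≡⟨ ⊛-congˡ [1-q³][1-q⁴]≗1-q³-q⁴+q⁷ g n ⟩
  ((q^ 0 ⊖ q^ 3 ⊖ q^ 4 ⊕ q^ 7) ⊛ g) n
    ≡⟨ ⊛-distribʳ-⊕ (q^ 0 ⊖ q^ 3 ⊖ q^ 4) (q^ 7) g n ⟩
  ((q^ 0 ⊖ q^ 3 ⊖ q^ 4) ⊛ g) n +ℚ (q^ 7 ⊛ g) n
    ≡⟨ cong (_+ℚ (q^ 7 ⊛ g) n) (⊛-distribʳ-⊖ (q^ 0 ⊖ q^ 3) (q^ 4) g n) ⟩
  ((q^ 0 ⊖ q^ 3) ⊛ g) n -ℚ (q^ 4 ⊛ g) n +ℚ (q^ 7 ⊛ g) n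
    ≡⟨ cong (λ x → x -ℚ (q^ 4 ⊛ g) n +ℚ (q^ 7 ⊛ g) n) (⊛-distribʳ-⊖ (q^ 0) (q^ 3) g n) ⟩
  (q^ 0 ⊛ g) n -ℚ (q^ 3 ⊛ g) n -ℚ (q^ 4 ⊛ g) n +ℚ (q^ 7 ⊛ g) n
    ≡⟨ cong₂ _+ℚ_ (cong₂ _-ℚ_ (cong₂ _-ℚ_ (q^-⊛ 0 g n) (q^-⊛ 3 g n)) (q^-⊛ 4 g n))
                  (q^-⊛ 7 g n) ⟩
  (g ⊖ shift 3 g ⊖ shift 4 g ⊕ shift 7 g) n ∎

shift-suc-below : ∀ (P : ℚ → Set) {k h} n → P 0ℚ → (∀ {m} → m < n → P (h m)) → P (shift (suc k) h n)
shift-suc-below P         zero    P0 Ph = P0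
shift-suc-below P {zero}  (suc n) P0 Ph = Ph (ℕ.n<1+n n)
shift-suc-below P {suc k} (suc n) P0 Ph = shift-suc-below P {k} n P0 (Ph ∘ ℕ.m<n⇒m<1+n)

data Trit : ℚ → Set where
  -1ᵗ : Trit (- 1ℚ)
  0ᵗ  : Trit 0ℚ
  1ᵗ  : Trit 1ℚ

Trit-neg : ∀ {x} → Trit x → Trit (- x)
Trit-neg -1ᵗ = 1ᵗ
Trit-neg 0ᵗ  = 0ᵗ
Trit-neg 1ᵗ  = -1ᵗ

Trit⇒≥-1 : ∀ {x} → Trit x → - 1ℚ ≤ℚ x
Trit⇒≥-1 -1ᵗ = ℚ.≤-refl
Trit⇒≥-1 0ᵗ  = from-yes (- 1ℚ ℚ.≤? 0ℚ)
Trit⇒≥-1 1ᵗ  = from-yes (- 1ℚ ℚ.≤? 1ℚ)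

module _ (a c : ℕ) (f : FPS) (f-rec : ∀ n → f n +ℚ shift (suc c) f n ≡ q^ a n) where

  private
    f≡q^a-shift : ∀ n → f n ≡ q^ a n -ℚ shift (suc c) f n
    f≡q^a-shift n = trans (solve 2 (λ x y → x := (x :+ y) :- y) refl (f n) (shift (suc c) f n))
                          (cong (_-ℚ shift (suc c) f n) (f-rec n))

  coeff-below-a≡0 : ∀ n → n < a → f n ≡ 0ℚ
  coeff-below-a≡0 = <-rec (λ n → n < a → f n ≡ 0ℚ) λ n rec n<a → begin
    f n
      ≡⟨ f≡q^a-shift n ⟩
    q^ a n -ℚ shift (suc c) f n
      ≡⟨ cong₂ _-ℚ_ (q^-off (ℕ.<⇒≢ n<a))
                    (shift-suc-below (_≡ 0ℚ) n refl (λ m<n → rec m<n (ℕ.<-trans m<n n<a))) ⟩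
    0ℚ -ℚ 0ℚ ∎

  coeff-a≡1 : f a ≡ 1ℚ
  coeff-a≡1 = trans (f≡q^a-shift a) (cong₂ _-ℚ_ (q^-diag a)
                (shift-suc-below (_≡ 0ℚ) a refl (λ {m} → coeff-below-a≡0 m)))

  coeff-off-a : ∀ {n} → n ≢ a → f n ≡ - shift (suc c) f n
  coeff-off-a {n} n≢a = trans (f≡q^a-shift n)
    (trans (cong (_-ℚ shift (suc c) f n) (q^-off n≢a)) (ℚ.+-identityˡ _))

  coeff-trit : ∀ n → Trit (f n)
  coeff-trit = <-rec (Trit ∘ f) λ n rec → case n ≟ a of λ where
    (yes refl) → subst Trit (sym coeff-a≡1) 1ᵗ
    (no n≢a)   → subst Trit (sym (coeff-off-a n≢a)) (Trit-neg (shift-suc-below Trit n 0ᵗ rec))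

half-nonneg : ∀ x → 0ℚ ≤ℚ x +ℚ x → 0ℚ ≤ℚ x
half-nonneg x 0≤2x with 0ℚ ℚ.≤? x
... | yes 0≤x = 0≤x
... | no 0≰x  = contradiction (ℚ.≤-<-trans 0≤2x (ℚ.+-mono-< x<0 x<0)) (ℚ.<-irrefl refl)
  where x<0 = ℚ.≰⇒> 0≰x

q^a/[1+q^c]≥-1 : ∀ a c (f : FPS) → (∀ n → f n +ℚ shift c f n ≡ q^ a n) → ∀ n → - 1ℚ ≤ℚ f n
q^a/[1+q^c]≥-1 a zero    f f-rec n =
  ℚ.≤-trans (from-yes (- 1ℚ ℚ.≤? 0ℚ))
            (half-nonneg (f n) (subst (0ℚ ≤ℚ_) (sym (f-rec n)) (q^-nonneg a n)))
q^a/[1+q^c]≥-1 a (suc c) f f-rec n = Trit⇒≥-1 (coeff-trit a c f f-rec n)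

sum-of-threes-and-fours : ∀ r → ∃₂ λ k l → 6 + r ≡ k * 3 + l * 4
sum-of-threes-and-fours 0 = 2 , 0 , refl
sum-of-threes-and-fours 1 = 1 , 1 , refl
sum-of-threes-and-fours 2 = 0 , 2 , refl
sum-of-threes-and-fours (suc (suc (suc r))) with sum-of-threes-and-fours r
... | k , l , eq = suc k , l , cong (3 +_) eq

module _ (b : ℕ) (g : FPS) (g-rec : ∀ n → (g ⊖ shift 3 g ⊖ shift 4 g ⊕ shift 7 g) n ≡ q^ b n) where

  private
    G : ℕ → ℚ
    G = shift 7 g

    Δ : ℕ → ℚ
    Δ m = G (4 + m) -ℚ G m

    Δ-step : ∀ m → Δ (3 + m) ≡ Δ m +ℚ q^ b m
    Δ-step m = trans (solve 4 (λ w x y z → w :- y := (x :- z) :+ (w :- x :- y :+ z)) refl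
                        (G (7 + m)) (G (4 + m)) (G (3 + m)) (G m))
                     (cong (Δ m +ℚ_) (g-rec m))

    G-step : ∀ m → G (4 + m) ≡ G m +ℚ Δ m
    G-step m = solve 2 (λ w z → w := z :+ (w :- z)) refl (G (4 + m)) (G m)

    Δ-nonneg : ∀ m → 0ℚ ≤ℚ Δ m
    Δ-nonneg 0 = ℚ.≤-refl
    Δ-nonneg 1 = ℚ.≤-refl
    Δ-nonneg 2 = ℚ.≤-refl
    Δ-nonneg (suc (suc (suc m))) =
      subst (0ℚ ≤ℚ_) (sym (Δ-step m)) (ℚ.+-mono-≤ (Δ-nonneg m) (q^-nonneg b m))

    Δ-pos : ∀ k → 1ℚ ≤ℚ Δ (k * 3 + (3 + b))
    Δ-pos zero    = subst (1ℚ ≤ℚ_) (sym (trans (Δ-step b) (cong (Δ b +ℚ_) (q^-diag b))))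
                      (ℚ.+-mono-≤ (Δ-nonneg b) ℚ.≤-refl)
    Δ-pos (suc k) = subst (1ℚ ≤ℚ_) (sym (Δ-step (k * 3 + (3 + b))))
                      (ℚ.+-mono-≤ (Δ-pos k) (q^-nonneg b (k * 3 + (3 + b))))

    G-nonneg : ∀ m → 0ℚ ≤ℚ G m
    G-nonneg 0 = ℚ.≤-refl
    G-nonneg 1 = ℚ.≤-refl
    G-nonneg 2 = ℚ.≤-refl
    G-nonneg 3 = ℚ.≤-refl
    G-nonneg (suc (suc (suc (suc m)))) =
      subst (0ℚ ≤ℚ_) (sym (G-step m)) (ℚ.+-mono-≤ (G-nonneg m) (Δ-nonneg m))

    G-pos : ∀ l {m} → 1ℚ ≤ℚ Δ m → 1ℚ ≤ℚ G (l * 4 + (4 + m))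
    G-pos zero    {m} 1≤Δm = subst (1ℚ ≤ℚ_) (sym (G-step m)) (ℚ.+-mono-≤ (G-nonneg m) 1≤Δm)
    G-pos (suc l) {m} 1≤Δm = subst (1ℚ ≤ℚ_) (sym (G-step (l * 4 + (4 + m))))
                               (ℚ.+-mono-≤ (G-pos l 1≤Δm) (Δ-nonneg (l * 4 + (4 + m))))

    coeff-pos : ∀ k l → 1ℚ ≤ℚ g (b + (k * 3 + l * 4))
    coeff-pos k l = subst (λ i → 1ℚ ≤ℚ G i) (reindex b k l) (G-pos l (Δ-pos k))
      where
      reindex : ∀ b k l → l * 4 + (4 + (k * 3 + (3 + b))) ≡ 7 + (b + (k * 3 + l * 4))
      reindex = solve-∀

  q^b/[1-q³][1-q⁴]≥1 : ∀ n → b + 6 ≤ n → 1ℚ ≤ℚ g n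
  q^b/[1-q³][1-q⁴]≥1 n b+6≤n with sum-of-threes-and-fours (n ∸ (b + 6))
  ... | k , l , eq = subst (λ i → 1ℚ ≤ℚ g i) b+3k+4l≡n (coeff-pos k l)
    where
    b+3k+4l≡n : b + (k * 3 + l * 4) ≡ n
    b+3k+4l≡n = begin
      b + (k * 3 + l * 4)        ≡⟨ cong (b +_) eq ⟨
      b + (6 + (n ∸ (b + 6)))    ≡⟨ ℕ.+-assoc b 6 _ ⟨
      b + 6 + (n ∸ (b + 6))      ≡⟨ ℕ.m+[n∸m]≡n b+6≤n ⟩
      n                          ∎

lemma3p1 : (a b c : ℕ) (f g : FPS)
    → (∀ n → ((q^ 0 ⊕ q^ c) ⊛ f) n ≡ q^ a n)
    → (∀ n → (((q^ 0 ⊖ q^ 3) ⊛ (q^ 0 ⊖ q^ 4)) ⊛ g) n ≡ q^ b n)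
    → ∀ n → b + 6 ≤ n → 0ℚ ≤ℚ f n +ℚ g n
lemma3p1 a b c f g f-eq g-eq n b+6≤n = ℚ.+-mono-≤ f-bound g-bound
  where
  f-bound : - 1ℚ ≤ℚ f n
  f-bound = q^a/[1+q^c]≥-1 a c f (λ m → trans (sym (⊛-1+q^ c f m)) (f-eq m)) n

  g-bound : 1ℚ ≤ℚ g n
  g-bound = q^b/[1-q³][1-q⁴]≥1 b g (λ m → trans (sym (⊛-[1-q³][1-q⁴] g m)) (g-eq m)) n b+6≤n
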